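{- For all CNF-terms $M,N$ and every variable $x$, $([N\backslash x]M)^{\wr}=[\lambda x.M^{\wr}/k]N^{\wr}$.
   Context: Terms up to $\alpha$-equivalence; substitution capture-avoiding. CNF: terms $M::=V\mid V(W,x.M)$ ($x$ bound in $M$); values $V,W::=x\mid\lambda x.M$. Left substitution: $[V\backslash x]P=[V/x]P$; $[V(W,y.N)\backslash x]P=V(W,y.[N\backslash x]P)$. cps: a fixed variable $k$. Commands $M::=kV\mid VW(\lambda x.N)$; values $V,W::=x\mid\lambda x.P$; terms $P::=\lambda k.M$. Substitution of a continuation for $k$ in a command: $[\lambda x.N/k](kV)=[V/x]N$; $[\lambda x.N/k](VW(\lambda y.M))=VW(\lambda y.[\lambda x.N/k]M)$. Translation CNF$\to$cps: $x^{\sim}=x$; $(\lambda x.M)^{\sim}=\lambda x.\lambda k.M^{\wr}$; $V^{\wr}=kV^{\sim}$; $(V(W,x.M))^{\wr}=V^{\sim}W^{\sim}(\lambda x.M^{\wr})$. -}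

module Defs where

open import Data.Nat using (ℕ; zero; suc)
open import Data.Fin using (Fin; zero; suc)

-- Well-scoped de Bruijn syntax (terms up to α-equivalence).
-- A term of type `X n` has its free variables among `Fin n`.

-- CNF:  M ::= V | V(W, x.M)      V, W ::= x | λx.M

mutual
  data Val (n : ℕ) : Set where
    var : Fin n → Val n
    lam : Tm (suc n) → Val n

  data Tm (n : ℕ) : Set where
    ret : Val n → Tm n
    app : Val n → Val n → Tm (suc n) → Tm n

-- cps:  commands M ::= kV | V W (λx.N);  values V ::= x | λx.P;
--       terms P ::= λk.M   (k a fixed distinguished variable, not an
--       ordinary variable, so it is not part of the de Bruijn context)

mutual
  data CVal (n : ℕ) : Set where
    cvar : Fin n → CVal n
    clam : CTm (suc n) → CVal n

  data CTm (n : ℕ) : Set where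
    klam : Cmd n → CTm n

  data Cmd (n : ℕ) : Set where
    kret : CVal n → Cmd n
    capp : CVal n → CVal n → Cmd (suc n) → Cmd n

ext : ∀ {n m} → (Fin n → Fin m) → Fin (suc n) → Fin (suc m)
ext ρ zero    = zero
ext ρ (suc i) = suc (ρ i)

mutual
  renV : ∀ {n m} → (Fin n → Fin m) → Val n → Val m
  renV ρ (var i) = var (ρ i)
  renV ρ (lam M) = lam (renT (ext ρ) M)

  renT : ∀ {n m} → (Fin n → Fin m) → Tm n → Tm m
  renT ρ (ret V)     = ret (renV ρ V)
  renT ρ (app V W M) = app (renV ρ V) (renV ρ W) (renT (ext ρ) M)

mutual
  crenV : ∀ {n m} → (Fin n → Fin m) → CVal n → CVal m
  crenV ρ (cvar i) = cvar (ρ i)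
  crenV ρ (clam P) = clam (crenP (ext ρ) P)

  crenP : ∀ {n m} → (Fin n → Fin m) → CTm n → CTm m
  crenP ρ (klam M) = klam (crenC ρ M)

  crenC : ∀ {n m} → (Fin n → Fin m) → Cmd n → Cmd m
  crenC ρ (kret V)     = kret (crenV ρ V)
  crenC ρ (capp V W M) = capp (crenV ρ V) (crenV ρ W) (crenC (ext ρ) M)

exts : ∀ {n m} → (Fin n → Val m) → Fin (suc n) → Val (suc m)
exts σ zero    = var zero
exts σ (suc i) = renV suc (σ i)

mutual
  subV : ∀ {n m} → (Fin n → Val m) → Val n → Val m
  subV σ (var i) = σ i
  subV σ (lam M) = lam (subT (exts σ) M)

  subT : ∀ {n m} → (Fin n → Val m) → Tm n → Tm m
  subT σ (ret V)     = ret (subV σ V)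
  subT σ (app V W M) = app (subV σ V) (subV σ W) (subT (exts σ) M)

sub0 : ∀ {n} → Val n → Fin (suc n) → Val n
sub0 V zero    = V
sub0 V (suc i) = var i

cexts : ∀ {n m} → (Fin n → CVal m) → Fin (suc n) → CVal (suc m)
cexts σ zero    = cvar zero
cexts σ (suc i) = crenV suc (σ i)

mutual
  csubV : ∀ {n m} → (Fin n → CVal m) → CVal n → CVal m
  csubV σ (cvar i) = σ i
  csubV σ (clam P) = clam (csubP (cexts σ) P)

  csubP : ∀ {n m} → (Fin n → CVal m) → CTm n → CTm m
  csubP σ (klam M) = klam (csubC σ M)

  csubC : ∀ {n m} → (Fin n → CVal m) → Cmd n → Cmd m
  csubC σ (kret V)     = kret (csubV σ V)
  csubC σ (capp V W M) = capp (csubV σ V) (csubV σ W) (csubC (cexts σ) M)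

csub0 : ∀ {n} → CVal n → Fin (suc n) → CVal n
csub0 V zero    = V
csub0 V (suc i) = cvar i

-- Left substitution  [N \ x] P   (x = variable zero of P's context)
--   [V \ x] P           = [V/x] P
--   [V(W,y.N) \ x] P    = V(W, y.[N \ x] P)     (y fresh for P)

lsub : ∀ {n} → Tm n → Tm (suc n) → Tm n
lsub (ret V)     P = subT (sub0 V) P
lsub (app V W N) P = app V W (lsub N (renT (ext suc) P))

-- Substitution of a continuation λx.N for k in a command:  [λx.N / k] M
--   [λx.N/k](k V)          = [V/x] N
--   [λx.N/k](V W (λy.M))   = V W (λy.[λx.N/k] M)   (y fresh for N)
-- The argument N : Cmd (suc n) is the body of λx.N (x = variable zero).

ksub : ∀ {n} → Cmd (suc n) → Cmd n → Cmd n
ksub N (kret V)     = csubC (csub0 V) N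
ksub N (capp V W M) = capp V W (ksub (crenC (ext suc) N) M)

-- Translation CNF → cps:  V^~ (trV) and M^≀ (trT)

mutual
  trV : ∀ {n} → Val n → CVal n
  trV (var i) = cvar i
  trV (lam M) = clam (klam (trT M))

  trT : ∀ {n} → Tm n → Cmd n
  trT (ret V)     = kret (trV V)
  trT (app V W M) = capp (trV V) (trV W) (trT M)

module Submission where

open import Defs
open import Data.Nat using (ℕ; suc)
open import Data.Fin using (Fin; zero; suc)
open import Function using (_∘_)
open import Relation.Binary.PropositionalEquality
  using (_≡_; _≗_; refl; cong; trans; module ≡-Reasoning)

-- The translation commutes with renaming and with value substitution.
-- Induction on N then proves the theorem: for N = V both sides are the
-- substitution of V for x in M (resp. of V~ in M^≀), and for N = V(W,y.N')
-- both sides start with V~ W~ and the induction hypothesis applies to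
-- M weakened past y, whose translation is the weakened translation.

capp-cong : ∀ {n} {V V′ W W′ : CVal n} {M M′ : Cmd (suc n)} →
            V ≡ V′ → W ≡ W′ → M ≡ M′ → capp V W M ≡ capp V′ W′ M′
capp-cong refl refl refl = refl

mutual
  trV-renV : ∀ {n m} (ρ : Fin n → Fin m) (V : Val n) →
             trV (renV ρ V) ≡ crenV ρ (trV V)
  trV-renV ρ (var i) = refl
  trV-renV ρ (lam M) = cong (clam ∘ klam) (trT-renT (ext ρ) M)

  trT-renT : ∀ {n m} (ρ : Fin n → Fin m) (M : Tm n) →
             trT (renT ρ M) ≡ crenC ρ (trT M)
  trT-renT ρ (ret V)     = cong kret (trV-renV ρ V)
  trT-renT ρ (app V W M) =
    capp-cong (trV-renV ρ V) (trV-renV ρ W) (trT-renT (ext ρ) M)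

cexts-cong : ∀ {n m} {σ τ : Fin n → CVal m} → σ ≗ τ → cexts σ ≗ cexts τ
cexts-cong σ≗τ zero    = refl
cexts-cong σ≗τ (suc i) = cong (crenV suc) (σ≗τ i)

mutual
  csubV-cong : ∀ {n m} {σ τ : Fin n → CVal m} → σ ≗ τ → csubV σ ≗ csubV τ
  csubV-cong σ≗τ (cvar i) = σ≗τ i
  csubV-cong σ≗τ (clam P) = cong clam (csubP-cong (cexts-cong σ≗τ) P)

  csubP-cong : ∀ {n m} {σ τ : Fin n → CVal m} → σ ≗ τ → csubP σ ≗ csubP τ
  csubP-cong σ≗τ (klam M) = cong klam (csubC-cong σ≗τ M)

  csubC-cong : ∀ {n m} {σ τ : Fin n → CVal m} → σ ≗ τ → csubC σ ≗ csubC τ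
  csubC-cong σ≗τ (kret V)     = cong kret (csubV-cong σ≗τ V)
  csubC-cong σ≗τ (capp V W M) =
    capp-cong (csubV-cong σ≗τ V) (csubV-cong σ≗τ W)
              (csubC-cong (cexts-cong σ≗τ) M)

trV-exts : ∀ {n m} (σ : Fin n → Val m) → trV ∘ exts σ ≗ cexts (trV ∘ σ)
trV-exts σ zero    = refl
trV-exts σ (suc i) = trV-renV suc (σ i)

mutual
  trV-subV : ∀ {n m} (σ : Fin n → Val m) (V : Val n) →
             trV (subV σ V) ≡ csubV (trV ∘ σ) (trV V)
  trV-subV σ (var i) = refl
  trV-subV σ (lam M) = cong (clam ∘ klam) (trT-subT-exts σ M)

  trT-subT : ∀ {n m} (σ : Fin n → Val m) (M : Tm n) →
             trT (subT σ M) ≡ csubC (trV ∘ σ) (trT M)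
  trT-subT σ (ret V)     = cong kret (trV-subV σ V)
  trT-subT σ (app V W M) =
    capp-cong (trV-subV σ V) (trV-subV σ W) (trT-subT-exts σ M)

  trT-subT-exts : ∀ {n m} (σ : Fin n → Val m) (M : Tm (suc n)) →
                  trT (subT (exts σ) M) ≡ csubC (cexts (trV ∘ σ)) (trT M)
  trT-subT-exts σ M =
    trans (trT-subT (exts σ) M) (csubC-cong (trV-exts σ) (trT M))

trV-sub0 : ∀ {n} (V : Val n) → trV ∘ sub0 V ≗ csub0 (trV V)
trV-sub0 V zero    = refl
trV-sub0 V (suc i) = refl

trT-subT-sub0 : ∀ {n} (V : Val n) (M : Tm (suc n)) →
                trT (subT (sub0 V) M) ≡ csubC (csub0 (trV V)) (trT M)
trT-subT-sub0 V M =
  trans (trT-subT (sub0 V) M) (csubC-cong (trV-sub0 V) (trT M))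

lemma24 : ∀ {n : ℕ} (M : Tm (suc n)) (N : Tm n) →
          trT (lsub N M) ≡ ksub (trT M) (trT N)
lemma24 M (ret V)     = trT-subT-sub0 V M
lemma24 M (app V W N) = cong (capp (trV V) (trV W)) (begin
    trT (lsub N (renT (ext suc) M))    ≡⟨ lemma24 (renT (ext suc) M) N ⟩
    ksub (trT (renT (ext suc) M)) (trT N)
      ≡⟨ cong (λ L → ksub L (trT N)) (trT-renT (ext suc) M) ⟩
    ksub (crenC (ext suc) (trT M)) (trT N) ∎)
  where open ≡-Reasoning
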